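{- Let $[b]\in\mathfrak{B}$ and $[c]\in\mathfrak{C}$. Then $[b][c]\in(\mathfrak{B}+\mathfrak{C})\cap\mathfrak{D}$ if and only if there exist $[\gamma_1],[\gamma_2],[\gamma_3]\in J(K)$ with $$[\gamma_1]^{1+\sigma_2}=[1],\quad [\gamma_1]^{1+\sigma_1}=[b],\quad [\gamma_2]^{1+\sigma_2}=[b],\quad [\gamma_2]^{1+\sigma_1}=[c],\quad [\gamma_3]^{1+\sigma_2}=[c],\quad [\gamma_3]^{1+\sigma_1}=[1].$$
   Context: $F$ is a field with $\operatorname{char}(F)\ne 2$, $K=F(\sqrt{a_1},\sqrt{a_2})$ is a Galois extension with $G=\operatorname{Gal}(K/F)\simeq\mathbb{Z}/2\oplus\mathbb{Z}/2$, and $\sigma_1,\sigma_2\in G$ satisfy $\sigma_i(\sqrt{a_j})=(-1)^{\delta_{ij}}\sqrt{a_j}$. $J(K)=K^\times/K^{\times2}$ is an $\mathbb{F}_2[G]$-module written multiplicatively with exponential action; $[F^\times]$ denotes the image of $F^\times$ in $J(K)$. Define subspaces of $[F^\times]$: $\mathfrak{B}$ = set of $[f]\in[F^\times]$ for which there is $[\gamma]\in J(K)$ with $[\gamma]^{1+\sigma_2}=[1]$ and $[\gamma]^{1+\sigma_1}=[f]$; $\mathfrak{C}$ = set of $[f]\in[F^\times]$ for which there is $[\gamma]$ with $[\gamma]^{1+\sigma_1}=[1]$ and $[\gamma]^{1+\sigma_2}=[f]$; $\mathfrak{D}$ = set of $[f]\in[F^\times]$ for which there is $[\gamma]$ with $[\gamma]^{1+\sigma_1}=[\gamma]^{1+\sigma_2}=[f]$.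 For subspaces $U,V$, $U+V=\{uv:u\in U,v\in V\}$. -}

module Defs where

open import Level using (Level; _⊔_)
open import Algebra.Bundles using (CommutativeRing)
open import Data.Product using (Σ; ∃; _×_; _,_)
open import Relation.Nullary using (¬_)

-- A biquadratic Galois extension K = F(√a₁,√a₂) / F with char ≠ 2 and
-- Gal(K/F) = {id, σ₁, σ₂, σ₁σ₂} ≅ ℤ/2 ⊕ ℤ/2.
-- K is a field (commutative ring, 1 ≠ 0, nonzero elements invertible),
-- σ₁, σ₂ are commuting involutive ring automorphisms of K, and F is the
-- fixed field of G = ⟨σ₁, σ₂⟩ (K/F Galois with group G).
record BiquadExt (c ℓ : Level) : Set (Level.suc (c ⊔ ℓ)) where
  field
    K : CommutativeRing c ℓ
  open CommutativeRing K public
  field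
    1≉0     : ¬ (1# ≈ 0#)
    inverse : ∀ x → ¬ (x ≈ 0#) → ∃ λ y → x * y ≈ 1#
    char≠2  : ¬ (1# + 1# ≈ 0#)
    σ₁ σ₂   : Carrier → Carrier
    σ₁-cong : ∀ {x y} → x ≈ y → σ₁ x ≈ σ₁ y
    σ₂-cong : ∀ {x y} → x ≈ y → σ₂ x ≈ σ₂ y
    σ₁-+    : ∀ x y → σ₁ (x + y) ≈ σ₁ x + σ₁ y
    σ₂-+    : ∀ x y → σ₂ (x + y) ≈ σ₂ x + σ₂ y
    σ₁-*    : ∀ x y → σ₁ (x * y) ≈ σ₁ x * σ₁ y
    σ₂-*    : ∀ x y → σ₂ (x * y) ≈ σ₂ x * σ₂ y
    σ₁-1    : σ₁ 1# ≈ 1#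
    σ₂-1    : σ₂ 1# ≈ 1#
    σ₁-invol : ∀ x → σ₁ (σ₁ x) ≈ x
    σ₂-invol : ∀ x → σ₂ (σ₂ x) ≈ x
    σ-comm  : ∀ x → σ₁ (σ₂ x) ≈ σ₂ (σ₁ x)

  InF : Carrier → Set ℓ
  InF x = (σ₁ x ≈ x) × (σ₂ x ≈ x)

  field
    √a₁ √a₂ : Carrier
    √a₁≉0   : ¬ (√a₁ ≈ 0#)
    √a₂≉0   : ¬ (√a₂ ≈ 0#)
    a₁∈F    : InF (√a₁ * √a₁)
    a₂∈F    : InF (√a₂ * √a₂)
    σ₁√a₁   : σ₁ √a₁ ≈ - √a₁
    σ₁√a₂   : σ₁ √a₂ ≈ √a₂
    σ₂√a₁   : σ₂ √a₁ ≈ √a₁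
    σ₂√a₂   : σ₂ √a₂ ≈ - √a₂
    generated : ∀ x → ∃ λ f₀ → ∃ λ f₁ → ∃ λ f₂ → ∃ λ f₃ →
      InF f₀ × InF f₁ × InF f₂ × InF f₃ ×
      (x ≈ f₀ + f₁ * √a₁ + f₂ * √a₂ + f₃ * (√a₁ * √a₂))

-- J(K) = K^× / K^{×2}: an element [x] is represented by a nonzero x ∈ K,
-- and [x] = [y] iff x = y z² for some nonzero z.
module JK {c ℓ : Level} (S : BiquadExt c ℓ) where
  open BiquadExt S

  NZ : Carrier → Set ℓ
  NZ x = ¬ (x ≈ 0#)

  _~_ : Carrier → Carrier → Set (c ⊔ ℓ)
  x ~ y = ∃ λ z → NZ z × (x ≈ y * (z * z))

  _^1+_ : Carrier → (Carrier → Carrier) → Carrier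
  x ^1+ σ = x * σ x

  InFˣ : Carrier → Set (c ⊔ ℓ)
  InFˣ x = NZ x × ∃ λ f → InF f × NZ f × (x ~ f)

  𝔅 : Carrier → Set (c ⊔ ℓ)
  𝔅 f = InFˣ f × ∃ λ γ → NZ γ × ((γ ^1+ σ₂) ~ 1#) × ((γ ^1+ σ₁) ~ f)

  ℭ : Carrier → Set (c ⊔ ℓ)
  ℭ f = InFˣ f × ∃ λ γ → NZ γ × ((γ ^1+ σ₁) ~ 1#) × ((γ ^1+ σ₂) ~ f)

  𝔇 : Carrier → Set (c ⊔ ℓ)
  𝔇 f = InFˣ f × ∃ λ γ → NZ γ × ((γ ^1+ σ₁) ~ f) × ((γ ^1+ σ₂) ~ f)

  _⊕_ : (Carrier → Set (c ⊔ ℓ)) → (Carrier → Set (c ⊔ ℓ)) → Carrier → Set (c ⊔ ℓ)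
  (U ⊕ V) x = NZ x × ∃ λ u → ∃ λ v → U u × V v × (x ~ (u * v))

{-# OPTIONS --safe #-}
module Submission where

open import Defs
open import Data.Product using (∃; _×_; _,_; proj₁)
open import Function.Bundles using (_⇔_; mk⇔)
open import Level using (Level; _⊔_)

-- If β, ε witness b ∈ 𝔅 and e ∈ ℭ and δ witnesses b e ∈ 𝔇, then γ₂ = δ β ε
-- has norms [γ₂]^{1+σ₂} = [b e · 1 · e] = [b] and [γ₂]^{1+σ₁} = [b e · b · 1] = [e].
-- Conversely δ = γ₁ γ₂ γ₃ has both norms equal to [b e], and b e ∈ 𝔅 + ℭ
-- always holds, witnessed by b and e themselves.

module SquareClasses {c ℓ : Level} (S : BiquadExt c ℓ) where
  open BiquadExt S
  open JK S
  open import Algebra.Properties.CommutativeSemigroup *-commutativeSemigroup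
  open import Relation.Binary.Reasoning.Setoid setoid

  *-nonzero : ∀ {x y} → NZ x → NZ y → NZ (x * y)
  *-nonzero {x} {y} x≉0 y≉0 xy≈0 with inverse x x≉0
  ... | x⁻¹ , xx⁻¹≈1 = y≉0 (begin
    y                 ≈⟨ sym (*-identityˡ y) ⟩
    1# * y            ≈⟨ *-congʳ (sym xx⁻¹≈1) ⟩
    (x * x⁻¹) * y     ≈⟨ xy∙z≈y∙xz x x⁻¹ y ⟩
    x⁻¹ * (x * y)     ≈⟨ *-congˡ xy≈0 ⟩
    x⁻¹ * 0#          ≈⟨ zeroʳ x⁻¹ ⟩
    0#                ∎)

  ≈⇒~ : ∀ {x y} → x ≈ y → x ~ y
  ≈⇒~ {x} {y} x≈y = 1# , 1≉0 , (begin
    x             ≈⟨ x≈y ⟩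
    y             ≈⟨ sym (*-identityʳ y) ⟩
    y * 1#        ≈⟨ *-congˡ (sym (*-identityʳ 1#)) ⟩
    y * (1# * 1#) ∎)

  ~-trans : ∀ {x y w} → x ~ y → y ~ w → x ~ w
  ~-trans {x} {y} {w} (z , z≉0 , x≈yzz) (z′ , z′≉0 , y≈wz′z′) =
    z′ * z , *-nonzero z′≉0 z≉0 , (begin
      x                         ≈⟨ x≈yzz ⟩
      y * (z * z)               ≈⟨ *-congʳ y≈wz′z′ ⟩
      (w * (z′ * z′)) * (z * z) ≈⟨ *-assoc w _ _ ⟩
      w * ((z′ * z′) * (z * z)) ≈⟨ *-congˡ (interchange z′ z′ z z) ⟩
      w * ((z′ * z) * (z′ * z)) ∎)

  ~-* : ∀ {x y x′ y′} → x ~ y → x′ ~ y′ → (x * x′) ~ (y * y′)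
  ~-* {x} {y} {x′} {y′} (z , z≉0 , x≈yzz) (z′ , z′≉0 , x′≈y′z′z′) =
    z * z′ , *-nonzero z≉0 z′≉0 , (begin
      x * x′                            ≈⟨ *-cong x≈yzz x′≈y′z′z′ ⟩
      (y * (z * z)) * (y′ * (z′ * z′))  ≈⟨ interchange y _ y′ _ ⟩
      (y * y′) * ((z * z) * (z′ * z′))  ≈⟨ *-congˡ (interchange z z z′ z′) ⟩
      (y * y′) * ((z * z′) * (z * z′))  ∎)

  x*y*y~x : ∀ {x y} → NZ y → (x * y * y) ~ x
  x*y*y~x {x} {y} y≉0 = y , y≉0 , *-assoc x y y

  ^1+-* : ∀ {σ} → (∀ x y → σ (x * y) ≈ σ x * σ y) →
          ∀ g h → ((g * h) ^1+ σ) ≈ ((g ^1+ σ) * (h ^1+ σ))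
  ^1+-* {σ} σ-* g h = begin
    (g * h) * σ (g * h)   ≈⟨ *-congˡ (σ-* g h) ⟩
    (g * h) * (σ g * σ h) ≈⟨ interchange g h (σ g) (σ h) ⟩
    (g * σ g) * (h * σ h) ∎

  ^1+-~-* : ∀ {σ} → (∀ x y → σ (x * y) ≈ σ x * σ y) →
            ∀ {g h p q} → (g ^1+ σ) ~ p → (h ^1+ σ) ~ q → ((g * h) ^1+ σ) ~ (p * q)
  ^1+-~-* σ-* {g} {h} gᴺ~p hᴺ~q = ~-trans (≈⇒~ (^1+-* σ-* g h)) (~-* gᴺ~p hᴺ~q)

  InFˣ-* : ∀ {x y} → InFˣ x → InFˣ y → InFˣ (x * y)
  InFˣ-* (x≉0 , f , (σ₁f≈f , σ₂f≈f) , f≉0 , x~f) (y≉0 , g , (σ₁g≈g , σ₂g≈g) , g≉0 , y~g) =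
    *-nonzero x≉0 y≉0 , f * g ,
    (trans (σ₁-* f g) (*-cong σ₁f≈f σ₁g≈g) , trans (σ₂-* f g) (*-cong σ₂f≈f σ₂g≈g)) ,
    *-nonzero f≉0 g≉0 , ~-* x~f y~g

  NormTriple : Carrier → Carrier → Set (c ⊔ ℓ)
  NormTriple b e =
    ∃ λ γ₁ → ∃ λ γ₂ → ∃ λ γ₃ → NZ γ₁ × NZ γ₂ × NZ γ₃ ×
      ((γ₁ ^1+ σ₂) ~ 1#) × ((γ₁ ^1+ σ₁) ~ b) ×
      ((γ₂ ^1+ σ₂) ~ b) × ((γ₂ ^1+ σ₁) ~ e) ×
      ((γ₃ ^1+ σ₂) ~ e) × ((γ₃ ^1+ σ₁) ~ 1#)

lemma3p1 : ∀ {c ℓ} (S : BiquadExt c ℓ) →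
    let open BiquadExt S in
    let open JK S in
    ∀ b e → 𝔅 b → ℭ e →
      (((𝔅 ⊕ ℭ) (b * e) × 𝔇 (b * e)) ⇔
       (∃ λ γ₁ → ∃ λ γ₂ → ∃ λ γ₃ → NZ γ₁ × NZ γ₂ × NZ γ₃ ×
         ((γ₁ ^1+ σ₂) ~ 1#) × ((γ₁ ^1+ σ₁) ~ b) ×
         ((γ₂ ^1+ σ₂) ~ b) × ((γ₂ ^1+ σ₁) ~ e) ×
         ((γ₃ ^1+ σ₂) ~ e) × ((γ₃ ^1+ σ₁) ~ 1#)))
lemma3p1 S b e b∈𝔅@(b∈Fˣ , β , β≉0 , βσ₂~1 , βσ₁~b) e∈ℭ@(e∈Fˣ , ε , ε≉0 , εσ₁~1 , εσ₂~e) =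
  mk⇔ to from
  where
  open BiquadExt S
  open JK S
  open SquareClasses S

  to : ((𝔅 ⊕ ℭ) (b * e) × 𝔇 (b * e)) → NormTriple b e
  to (_ , (_ , δ , δ≉0 , δσ₁~be , δσ₂~be)) =
    β , δ * β * ε , ε , β≉0 , *-nonzero (*-nonzero δ≉0 β≉0) ε≉0 , ε≉0 ,
    βσ₂~1 , βσ₁~b , γ₂σ₂~b , γ₂σ₁~e , εσ₂~e , εσ₁~1
    where
    γ₂σ₂~b : ((δ * β * ε) ^1+ σ₂) ~ b
    γ₂σ₂~b = ~-trans (^1+-~-* σ₂-* (^1+-~-* σ₂-* δσ₂~be βσ₂~1) εσ₂~e)
                     (~-trans (≈⇒~ (*-congʳ (*-identityʳ (b * e)))) (x*y*y~x (proj₁ e∈Fˣ)))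

    γ₂σ₁~e : ((δ * β * ε) ^1+ σ₁) ~ e
    γ₂σ₁~e = ~-trans (^1+-~-* σ₁-* (^1+-~-* σ₁-* δσ₁~be βσ₁~b) εσ₁~1)
                     (~-trans (≈⇒~ (trans (*-identityʳ _) (*-congʳ (*-comm b e))))
                              (x*y*y~x (proj₁ b∈Fˣ)))

  from : NormTriple b e → ((𝔅 ⊕ ℭ) (b * e) × 𝔇 (b * e))
  from (γ₁ , γ₂ , γ₃ , γ₁≉0 , γ₂≉0 , γ₃≉0 , γ₁σ₂~1 , γ₁σ₁~b , γ₂σ₂~b , γ₂σ₁~e , γ₃σ₂~e , γ₃σ₁~1) =
    (be≉0 , b , e , b∈𝔅 , e∈ℭ , ≈⇒~ refl) ,
    InFˣ-* b∈Fˣ e∈Fˣ , γ₁ * γ₂ * γ₃ , *-nonzero (*-nonzero γ₁≉0 γ₂≉0) γ₃≉0 ,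
    ~-trans (^1+-~-* σ₁-* (^1+-~-* σ₁-* γ₁σ₁~b γ₂σ₁~e) γ₃σ₁~1) (≈⇒~ (*-identityʳ (b * e))) ,
    ~-trans (^1+-~-* σ₂-* (^1+-~-* σ₂-* γ₁σ₂~1 γ₂σ₂~b) γ₃σ₂~e) (≈⇒~ (*-congʳ (*-identityˡ b)))
    where
    be≉0 : NZ (b * e)
    be≉0 = *-nonzero (proj₁ b∈Fˣ) (proj₁ e∈Fˣ)
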